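{- Let $n\ge 4$ and $i$ be integers. Then: (i) if $\mathcal{C}_{n-1}^{i-1}=\mathcal{C}_{n-3}^{i-1}=\emptyset$, then $\mathcal{C}_{n-2}^{i-1}=\emptyset$; (ii) if $\mathcal{C}_{n-1}^{i-1}\neq\emptyset$ and $\mathcal{C}_{n-3}^{i-1}\neq\emptyset$, then $\mathcal{C}_{n-2}^{i-1}\neq\emptyset$; (iii) if $\mathcal{C}_{n-1}^{i-1}=\mathcal{C}_{n-2}^{i-1}=\mathcal{C}_{n-3}^{i-1}=\emptyset$, then $\mathcal{C}_{n}^{i}=\emptyset$.
   Context: For an integer $m\ge 3$, $C_m$ denotes the cycle with vertex set $[m]=\{1,2,\dots,m\}$ and edge set $\{\{1,2\},\{2,3\},\dots,\{m-1,m\},\{m,1\}\}$; by convention $C_1$ is the graph with the single vertex $1$, and $C_2$ is the graph on $\{1,2\}$ with the single edge $\{1,2\}$. A set $S$ of vertices of a graph $G$ is a dominating set if every vertex not in $S$ is adjacent to at least one vertex of $S$. For $m\ge1$ and an integer $j$, $\mathcal{C}_m^j$ denotes the family of dominating sets of $C_m$ of cardinality $j$ (so it is empty if $j<0$ or $j>m$). -}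

module Defs where

open import Data.Nat using (ℕ; zero; suc; _+_; _%_; NonZero)
open import Data.Fin using (Fin; toℕ)
open import Data.Fin.Subset using (Subset; _∈_; ∣_∣)
open import Data.Integer using (ℤ; +_)
open import Data.Product using (Σ; ∃; _×_)
open import Data.Sum using (_⊎_)
open import Data.Empty using (⊥)
open import Relation.Binary.PropositionalEquality using (_≡_; _≢_)

-- Vertices of C_m are Fin m; index k stands for vertex k+1 of [m].
-- For m ≥ 3 this is the cycle; for m = 2 the single edge {1,2};
-- for m = 1 there are no edges.
Adj : (m : ℕ) .{{_ : NonZero m}} → Fin m → Fin m → Set
Adj m a b = a ≢ b × (((toℕ a + 1) % m ≡ toℕ b) ⊎ ((toℕ b + 1) % m ≡ toℕ a))

IsDominating : (m : ℕ) .{{_ : NonZero m}} → Subset m → Set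
IsDominating m S = ∀ v → v ∈ S ⊎ Σ (Fin m) (λ u → u ∈ S × Adj m u v)

InC : (m : ℕ) .{{_ : NonZero m}} → ℤ → Subset m → Set
InC m j S = IsDominating m S × (+ ∣ S ∣ ≡ j)

-- 𝒞_m^j ≠ ∅, for m ≥ 1 (written m = suc k). The m = 0 clause is a
-- dummy never used by the statement (there n ≥ 4, so all sizes are ≥ 1).
CNonempty : ℕ → ℤ → Set
CNonempty zero j = ⊥
CNonempty (suc k) j = ∃ λ S → InC (suc k) j S

-- A dominating set S of C_m has m ≤ 3|S|, since the closed neighbourhoods of
-- its members cover the cycle and each has at most three vertices.
-- Conversely every third vertex already dominates, and supersets of dominating
-- sets dominate, so 𝒞_m^s ≠ ∅ exactly when s ≤ m ≤ 3s.  For fixed s the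
-- admissible lengths m thus form an interval, and (i)–(iii) are statements
-- about how the intervals [s, 3s] and [s + 1, 3s + 3] meet n - 3, n - 2, n - 1.
module Submission where

open import Defs
open import Data.Nat using (ℕ; _≤_; _∸_)
open import Data.Integer using (ℤ; _-_; +_)
open import Data.Product using (_×_)
open import Relation.Nullary using (¬_)

open import Data.Bool using (Bool)
open import Data.Fin using (Fin; zero; suc; toℕ; inject₁; lower₁)
open import Data.Fin.Properties using (toℕ<n; toℕ-inject₁; toℕ-lower₁; inject₁-lower₁)
open import Data.Fin.Subset using (Subset; _∈_; _⊆_; ∣_∣; inside; outside)
open import Data.Fin.Subset.Properties using (⊆-refl; s⊆s; out⊆; ∣p∣≤n)
open import Data.Integer.Properties using (+-injective)
open import Data.Nat using (zero; suc; _+_; _*_; _%_; z≤n; s≤s; NonZero; _≤?_; _≟_)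
open import Data.Nat.DivMod using (%-distribˡ-+; m%n%n≡m%n; [m+n]%n≡m%n; m<n⇒m%n≡m; n%n≡0; %-congˡ)
open import Data.Nat.Properties
open import Algebra.Properties.CommutativeSemigroup +-commutativeSemigroup using (interchange)
open import Data.Product using (∃-syntax; _,_)
open import Data.Sum using (_⊎_; inj₁; inj₂; [_,_])
open import Data.Vec using ([]; _∷_; here; there; tabulate; lookup)
open import Data.Vec.Properties using (lookup∘tabulate; lookup⇒[]=)
open import Function using (_∘_)
open import Relation.Nullary using (Dec; yes; no)
open import Relation.Binary.PropositionalEquality
  using (_≡_; _≢_; refl; sym; trans; cong; cong₂; subst; module ≡-Reasoning)

∑< : ℕ → (ℕ → ℕ) → ℕ
∑< zero    h = 0
∑< (suc m) h = h 0 + ∑< m (h ∘ suc)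

∑<-suc : ∀ m h → ∑< (suc m) h ≡ ∑< m h + h m
∑<-suc zero    h = +-comm (h 0) 0
∑<-suc (suc m) h = begin
  h 0 + ∑< (suc m) (h ∘ suc)       ≡⟨ cong (_+_ (h 0)) (∑<-suc m (h ∘ suc)) ⟩
  h 0 + (∑< m (h ∘ suc) + h (suc m)) ≡⟨ +-assoc (h 0) _ _ ⟨
  ∑< (suc m) h + h (suc m)          ∎
  where open ≡-Reasoning

∑<-rotate : ∀ m h → h m ≡ h 0 → ∑< m (h ∘ suc) ≡ ∑< m h
∑<-rotate m h hm≡h0 = +-cancelˡ-≡ (h 0) _ _ (begin
  h 0 + ∑< m (h ∘ suc) ≡⟨ ∑<-suc m h ⟩
  ∑< m h + h m         ≡⟨ cong (_+_ (∑< m h)) hm≡h0 ⟩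
  ∑< m h + h 0         ≡⟨ +-comm (∑< m h) (h 0) ⟩
  h 0 + ∑< m h         ∎)
  where open ≡-Reasoning

∑<-periodic-shift : ∀ m h → (∀ y → h (m + y) ≡ h y) → ∀ c → ∑< m (λ y → h (c + y)) ≡ ∑< m h
∑<-periodic-shift m h periodic zero    = refl
∑<-periodic-shift m h periodic (suc c) = begin
  ∑< m (λ y → h (suc (c + y))) ≡⟨ ∑<-periodic-shift m (h ∘ suc) periodic∘suc c ⟩
  ∑< m (h ∘ suc)               ≡⟨ ∑<-rotate m h (trans (cong h (sym (+-identityʳ m))) (periodic 0)) ⟩
  ∑< m h                       ∎
  where
  open ≡-Reasoning
  periodic∘suc : ∀ y → h (suc (m + y)) ≡ h (suc y)
  periodic∘suc y = trans (cong h (sym (+-suc m y))) (periodic (suc y))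

∑<-+ : ∀ m f g → ∑< m (λ y → f y + g y) ≡ ∑< m f + ∑< m g
∑<-+ zero    f g = refl
∑<-+ (suc m) f g = trans (cong (_+_ (f 0 + g 0)) (∑<-+ m (f ∘ suc) (g ∘ suc)))
                         (interchange (f 0) (g 0) _ _)

∑<-const : ∀ m c → ∑< m (λ _ → c) ≡ m * c
∑<-const zero    c = refl
∑<-const (suc m) c = cong (_+_ c) (∑<-const m c)

∑<-mono-≤ : ∀ m f g → (∀ (i : Fin m) → f (toℕ i) ≤ g (toℕ i)) → ∑< m f ≤ ∑< m g
∑<-mono-≤ zero    f g f≤g = z≤n
∑<-mono-≤ (suc m) f g f≤g = +-mono-≤ (f≤g zero) (∑<-mono-≤ m (f ∘ suc) (g ∘ suc) (f≤g ∘ suc))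

∑<-cong : ∀ m f g → (∀ (i : Fin m) → f (toℕ i) ≡ g (toℕ i)) → ∑< m f ≡ ∑< m g
∑<-cong zero    f g f≡g = refl
∑<-cong (suc m) f g f≡g = cong₂ _+_ (f≡g zero) (∑<-cong m (f ∘ suc) (g ∘ suc) (f≡g ∘ suc))

𝟙 : ∀ {m} → Subset m → ℕ → ℕ
𝟙 []            _       = 0
𝟙 (_ ∷ p)       (suc y) = 𝟙 p y
𝟙 (inside ∷ _)  zero    = 1
𝟙 (outside ∷ _) zero    = 0

∣p∣≡∑𝟙 : ∀ {m} (p : Subset m) → ∣ p ∣ ≡ ∑< m (𝟙 p)
∣p∣≡∑𝟙 []            = refl
∣p∣≡∑𝟙 (inside ∷ p)  = cong suc (∣p∣≡∑𝟙 p)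
∣p∣≡∑𝟙 (outside ∷ p) = ∣p∣≡∑𝟙 p

∈⇒𝟙≡1 : ∀ {m} {p : Subset m} {u} → u ∈ p → 𝟙 p (toℕ u) ≡ 1
∈⇒𝟙≡1 here       = refl
∈⇒𝟙≡1 (there u∈p) = ∈⇒𝟙≡1 u∈p

[m+n%d]%d≡[m+n]%d : ∀ m n d .{{_ : NonZero d}} → (m + n % d) % d ≡ (m + n) % d
[m+n%d]%d≡[m+n]%d m n d = begin
  (m + n % d) % d         ≡⟨ %-distribˡ-+ m (n % d) d ⟩
  (m % d + n % d % d) % d ≡⟨ cong (λ x → (m % d + x) % d) (m%n%n≡m%n n d) ⟩
  (m % d + n % d) % d     ≡⟨ %-distribˡ-+ m n d ⟨
  (m + n) % d             ∎
  where open ≡-Reasoning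

[n+m]%n≡m%n : ∀ m n .{{_ : NonZero n}} → (n + m) % n ≡ m % n
[n+m]%n≡m%n m n = trans (%-congˡ (+-comm n m)) ([m+n]%n≡m%n m n)

1≤a+b+c : ∀ a b c → a ≡ 1 ⊎ b ≡ 1 ⊎ c ≡ 1 → 1 ≤ a + b + c
1≤a+b+c _ _ _ (inj₁ refl)        = s≤s z≤n
1≤a+b+c a _ c (inj₂ (inj₁ refl)) = ≤-trans (m≤n+m 1 a) (m≤m+n (a + 1) c)
1≤a+b+c a b _ (inj₂ (inj₂ refl)) = m≤n+m 1 (a + b)

dominating⇒m≤3∣S∣ : ∀ {k} (S : Subset (suc k)) → IsDominating (suc k) S → suc k ≤ 3 * ∣ S ∣
dominating⇒m≤3∣S∣ {k} S dominating = begin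
  suc k                    ≡⟨ trans (∑<-const m 1) (*-identityʳ m) ⟨
  ∑< m (λ _ → 1)           ≤⟨ ∑<-mono-≤ m _ window window≥1 ⟩
  ∑< m window              ≡⟨ ∑<-window ⟩
  ∑< m g + ∑< m g + ∑< m g ≡⟨ a+a+a≡3*a (∑< m g) ⟩
  3 * ∑< m g               ≡⟨ cong (3 *_) (trans (∑<-cong m g (𝟙 S) g≡𝟙) (sym (∣p∣≡∑𝟙 S))) ⟩
  3 * ∣ S ∣                ∎
  where
  open ≤-Reasoning
  m : ℕ
  m = suc k

  g : ℕ → ℕ
  g y = 𝟙 S (y % m)

  shifted : ℕ → ℕ → ℕ
  shifted c t = g (c + t)

  -- Modulo m, the three offsets k, m and 1 + m read the vertices t - 1, t and t + 1.
  window : ℕ → ℕ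
  window t = shifted k t + shifted m t + shifted (suc m) t

  shift-invariant : ∀ c → ∑< m (shifted c) ≡ ∑< m g
  shift-invariant = ∑<-periodic-shift m g (λ y → cong (𝟙 S) ([n+m]%n≡m%n y m))

  ∑<-window : ∑< m window ≡ ∑< m g + ∑< m g + ∑< m g
  ∑<-window = begin-equality
    ∑< m window
      ≡⟨ ∑<-+ m (λ t → shifted k t + shifted m t) (shifted (suc m)) ⟩
    ∑< m (λ t → shifted k t + shifted m t) + ∑< m (shifted (suc m))
      ≡⟨ cong (_+ ∑< m (shifted (suc m))) (∑<-+ m (shifted k) (shifted m)) ⟩
    ∑< m (shifted k) + ∑< m (shifted m) + ∑< m (shifted (suc m))
      ≡⟨ cong₂ _+_ (cong₂ _+_ (shift-invariant k) (shift-invariant m)) (shift-invariant (suc m)) ⟩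
    ∑< m g + ∑< m g + ∑< m g ∎

  g≡𝟙 : ∀ (i : Fin m) → g (toℕ i) ≡ 𝟙 S (toℕ i)
  g≡𝟙 i = cong (𝟙 S) (m<n⇒m%n≡m (toℕ<n i))

  a+a+a≡3*a : ∀ a → a + a + a ≡ 3 * a
  a+a+a≡3*a a = trans (+-assoc a a a) (cong (λ x → a + (a + x)) (sym (+-identityʳ a)))

  hit : ∀ {u} y → u ∈ S → y % m ≡ toℕ u → g y ≡ 1
  hit y u∈S y%m≡u = trans (cong (𝟙 S) y%m≡u) (∈⇒𝟙≡1 u∈S)

  window≥1 : ∀ (v : Fin m) → 1 ≤ window (toℕ v)
  window≥1 v = 1≤a+b+c (shifted k t) (shifted m t) (shifted (suc m) t) (dominator-in-window (dominating v))
    where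
    t : ℕ
    t = toℕ v

    dominator-in-window : v ∈ S ⊎ ∃[ u ] u ∈ S × Adj m u v →
                          shifted k t ≡ 1 ⊎ shifted m t ≡ 1 ⊎ shifted (suc m) t ≡ 1
    dominator-in-window (inj₁ v∈S) =
      inj₂ (inj₁ (hit (m + t) v∈S (trans ([n+m]%n≡m%n t m) (m<n⇒m%n≡m (toℕ<n v)))))
    dominator-in-window (inj₂ (u , u∈S , _ , inj₁ [u+1]%m≡t)) = inj₁ (hit (k + t) u∈S (begin-equality
      (k + t) % m               ≡⟨ cong (λ x → (k + x) % m) [u+1]%m≡t ⟨
      (k + (toℕ u + 1) % m) % m ≡⟨ [m+n%d]%d≡[m+n]%d k (toℕ u + 1) m ⟩
      (k + (toℕ u + 1)) % m     ≡⟨ %-congˡ (trans (+-comm k (toℕ u + 1)) (+-assoc (toℕ u) 1 k)) ⟩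
      (toℕ u + m) % m           ≡⟨ [m+n]%n≡m%n (toℕ u) m ⟩
      toℕ u % m                 ≡⟨ m<n⇒m%n≡m (toℕ<n u) ⟩
      toℕ u                     ∎))
    dominator-in-window (inj₂ (u , u∈S , _ , inj₂ [t+1]%m≡u)) =
      inj₂ (inj₂ (hit (suc m + t) u∈S (begin-equality
      (suc m + t) % m ≡⟨ %-congˡ (trans (+-comm (suc m) t) (sym (+-assoc t 1 m))) ⟩
      (t + 1 + m) % m ≡⟨ [m+n]%n≡m%n (t + 1) m ⟩
      (t + 1) % m     ≡⟨ [t+1]%m≡u ⟩
      toℕ u           ∎)))

Adj-sym : ∀ {m} .{{_ : NonZero m}} {a b : Fin m} → Adj m a b → Adj m b a
Adj-sym (a≢b , inj₁ e) = (a≢b ∘ sym) , inj₂ e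
Adj-sym (a≢b , inj₂ e) = (a≢b ∘ sym) , inj₁ e

Adj-inject₁-suc : ∀ {k} (w : Fin k) → Adj (suc k) (inject₁ w) (suc w)
Adj-inject₁-suc {k} w = distinct , inj₁ (begin
  (toℕ (inject₁ w) + 1) % suc k ≡⟨ %-congˡ (trans (cong (_+ 1) (toℕ-inject₁ w)) (+-comm (toℕ w) 1)) ⟩
  suc (toℕ w) % suc k           ≡⟨ m<n⇒m%n≡m (s≤s (toℕ<n w)) ⟩
  suc (toℕ w)                   ∎)
  where
  open ≡-Reasoning
  distinct : inject₁ w ≢ suc w
  distinct eq = 1+n≢n (trans (sym (cong toℕ eq)) (toℕ-inject₁ w))

Adj-zero-last : ∀ {k} (v : Fin (suc k)) → toℕ v ≡ k → v ≢ zero → Adj (suc k) zero v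
Adj-zero-last {k} v v≡k v≢0 = v≢0 ∘ sym , inj₂ (begin
  (toℕ v + 1) % suc k ≡⟨ %-congˡ (trans (cong (_+ 1) v≡k) (+-comm k 1)) ⟩
  suc k % suc k       ≡⟨ n%n≡0 (suc k) ⟩
  0                   ∎)
  where open ≡-Reasoning

IsDominating-⊆ : ∀ {m} .{{_ : NonZero m}} {p q : Subset m} → p ⊆ q → IsDominating m p → IsDominating m q
IsDominating-⊆ p⊆q dominating v with dominating v
... | inj₁ v∈p               = inj₁ (p⊆q v∈p)
... | inj₂ (u , u∈p , u~v)   = inj₂ (u , p⊆q u∈p , u~v)

third : ℕ → Bool
third 0                   = inside
third 1                   = outside
third 2                   = outside
third (suc (suc (suc n))) = third n

third-window : ∀ n → third n ≡ inside ⊎ third (1 + n) ≡ inside ⊎ third (2 + n) ≡ inside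
third-window 0                   = inj₁ refl
third-window 1                   = inj₂ (inj₂ refl)
third-window 2                   = inj₂ (inj₁ refl)
third-window (suc (suc (suc n))) = third-window n

everyThird : (m : ℕ) → Subset m
everyThird m = tabulate (third ∘ toℕ)

3*∣everyThird∣≤m+2 : ∀ m → 3 * ∣ everyThird m ∣ ≤ m + 2
3*∣everyThird∣≤m+2 0                   = z≤n
3*∣everyThird∣≤m+2 1                   = ≤-refl
3*∣everyThird∣≤m+2 2                   = n≤1+n 3
3*∣everyThird∣≤m+2 (suc (suc (suc m))) =
  ≤-trans (≤-reflexive (*-suc 3 ∣ everyThird m ∣)) (s≤s (s≤s (s≤s (3*∣everyThird∣≤m+2 m))))

∈everyThird : ∀ {m} (u : Fin m) {n} → toℕ u ≡ n → third n ≡ inside → u ∈ everyThird m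
∈everyThird {m} u refl third≡inside =
  lookup⇒[]= u (everyThird m) (trans (lookup∘tabulate (third ∘ toℕ) u) third≡inside)

everyThird-dominating : ∀ k → IsDominating (suc k) (everyThird (suc k))
everyThird-dominating k zero    = inj₁ (∈everyThird zero refl refl)
everyThird-dominating k (suc w) with third-window (toℕ w)
... | inj₁ third[w]            =
  inj₂ (inject₁ w , ∈everyThird (inject₁ w) (toℕ-inject₁ w) third[w] , Adj-inject₁-suc w)
... | inj₂ (inj₁ third[v])     = inj₁ (∈everyThird (suc w) refl third[v])
... | inj₂ (inj₂ third[v+1])   with k ≟ toℕ (suc w)
...   | yes last = inj₂ (zero , ∈everyThird zero refl refl , Adj-zero-last (suc w) (sym last) λ ())
...   | no ¬last =
  inj₂ (suc v′ , ∈everyThird (suc v′) (cong suc (toℕ-lower₁ (suc w) ¬last)) third[v+1] , v′+1~v)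
  where
  v′ : Fin k
  v′ = lower₁ (suc w) ¬last
  v′+1~v : Adj (suc k) (suc v′) (suc w)
  v′+1~v = subst (Adj (suc k) (suc v′)) (inject₁-lower₁ (suc w) ¬last) (Adj-sym (Adj-inject₁-suc v′))

superset-of-size : ∀ {m} (p : Subset m) {s} → ∣ p ∣ ≤ s → s ≤ m → ∃[ q ] p ⊆ q × ∣ q ∣ ≡ s
superset-of-size []            {zero}  _  _          = [] , ⊆-refl , refl
superset-of-size (inside ∷ p)  {suc s} (s≤s ∣p∣≤s) (s≤s s≤m) with superset-of-size p ∣p∣≤s s≤m
... | q , p⊆q , ∣q∣≡s = inside ∷ q , s⊆s p⊆q , cong suc ∣q∣≡s
superset-of-size (outside ∷ p) {zero}  ∣p∣≤0 _ = outside ∷ p , ⊆-refl , n≤0⇒n≡0 ∣p∣≤0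
superset-of-size (outside ∷ p) {suc s} ∣p∣≤1+s (s≤s s≤m) with ∣ p ∣ ≤? s
... | no ∣p∣≰s = outside ∷ p , ⊆-refl , ≤-antisym ∣p∣≤1+s (≰⇒> ∣p∣≰s)
... | yes ∣p∣≤s with superset-of-size p ∣p∣≤s s≤m
...   | q , p⊆q , ∣q∣≡s = inside ∷ q , out⊆ p⊆q , cong suc ∣q∣≡s

dominating-of-size : ∀ k s → suc k ≤ 3 * s → s ≤ suc k → ∃[ S ] IsDominating (suc k) S × ∣ S ∣ ≡ s
dominating-of-size k s m≤3s s≤m with superset-of-size (everyThird (suc k)) ∣everyThird∣≤s s≤m
  where
  ∣everyThird∣≤s : ∣ everyThird (suc k) ∣ ≤ s
  ∣everyThird∣≤s = ≤-pred (*-cancelˡ-< 3 _ _ (begin-strict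
    3 * ∣ everyThird (suc k) ∣ ≤⟨ 3*∣everyThird∣≤m+2 (suc k) ⟩
    suc k + 2                  ≤⟨ +-monoˡ-≤ 2 m≤3s ⟩
    3 * s + 2                  <⟨ +-monoʳ-< (3 * s) (n<1+n 2) ⟩
    3 * s + 3                  ≡⟨ trans (*-suc 3 s) (+-comm 3 (3 * s)) ⟨
    3 * suc s                  ∎))
    where open ≤-Reasoning
... | S , everyThird⊆S , ∣S∣≡s = S , IsDominating-⊆ everyThird⊆S (everyThird-dominating k) , ∣S∣≡s

Feasible : ℕ → ℕ → Set
Feasible m s = s ≤ m × m ≤ 3 * s

nonempty⇒feasible : ∀ {k j} → CNonempty (suc k) j → ∃[ s ] j ≡ + s × Feasible (suc k) s
nonempty⇒feasible (S , dominating , ∣S∣≡j) =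
  ∣ S ∣ , sym ∣S∣≡j , ∣p∣≤n S , dominating⇒m≤3∣S∣ S dominating

feasible⇒nonempty : ∀ {k j s} → j ≡ + s → Feasible (suc k) s → CNonempty (suc k) j
feasible⇒nonempty {k} {s = s} refl (s≤m , m≤3s) with dominating-of-size k s m≤3s s≤m
... | S , dominating , ∣S∣≡s = S , dominating , cong +_ ∣S∣≡s

2+m≤3*[1+m] : ∀ m → 2 + m ≤ 3 * suc m
2+m≤3*[1+m] m = ≤-trans (s≤s (s≤s (m≤n⇒m≤1+n (m≤n*m m 3)))) (≤-reflexive (sym (*-suc 3 m)))

Feasible-between : ∀ {m s} → s ≤ m → 2 + m ≤ 3 * s → Feasible (1 + m) s
Feasible-between s≤m 2+m≤3s = m≤n⇒m≤1+n s≤m , ≤-trans (n≤1+n _) 2+m≤3s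

Feasible-split : ∀ {m s} → Feasible (1 + m) s → Feasible m s ⊎ Feasible (2 + m) s
Feasible-split {m} {s} (s≤1+m , 1+m≤3s) with s ≤? m
... | yes s≤m = inj₁ (s≤m , ≤-trans (n≤1+n m) 1+m≤3s)
... | no s≰m  = inj₂ (m≤n⇒m≤1+n s≤1+m , subst (λ x → 2 + m ≤ 3 * x) (sym s≡1+m) (2+m≤3*[1+m] m))
  where
  s≡1+m : s ≡ 1 + m
  s≡1+m = ≤-antisym s≤1+m (≰⇒> s≰m)

Feasible-pred : ∀ {m s} → Feasible (3 + m) (suc s) → Feasible m s ⊎ Feasible (1 + m) s ⊎ Feasible (2 + m) s
Feasible-pred {m} {s} (s≤s s≤2+m , 3+m≤3[1+s]) = by-cases (s ≤? m) (s ≤? 1 + m)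
  where
  m≤3s : m ≤ 3 * s
  m≤3s = ≤-pred (≤-pred (≤-pred (≤-trans 3+m≤3[1+s] (≤-reflexive (*-suc 3 s)))))

  by-cases : Dec (s ≤ m) → Dec (s ≤ 1 + m) → Feasible m s ⊎ Feasible (1 + m) s ⊎ Feasible (2 + m) s
  by-cases (yes s≤m) _           = inj₁ (s≤m , m≤3s)
  by-cases (no s≰m)  (yes s≤1+m) = inj₂ (inj₁ (s≤1+m , ≤-trans (≰⇒> s≰m) (m≤n*m s 3)))
  by-cases (no _)    (no s≰1+m)  = inj₂ (inj₂ (s≤2+m , ≤-trans (≰⇒> s≰1+m) (m≤n*m s 3)))

lemma3 : (n : ℕ) → 4 ≤ n → (i : ℤ) →
    let j = i - + 1 in
    (¬ CNonempty (n ∸ 1) j × ¬ CNonempty (n ∸ 3) j → ¬ CNonempty (n ∸ 2) j)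
    × (CNonempty (n ∸ 1) j × CNonempty (n ∸ 3) j → CNonempty (n ∸ 2) j)
    × (¬ CNonempty (n ∸ 1) j × ¬ CNonempty (n ∸ 2) j × ¬ CNonempty (n ∸ 3) j
        → ¬ CNonempty n i)
lemma3 1 (s≤s ()) _
lemma3 2 (s≤s (s≤s ())) _
lemma3 3 (s≤s (s≤s (s≤s ()))) _
lemma3 (suc (suc (suc (suc k)))) _ i = part-i , part-ii , part-iii
  where
  j : ℤ
  j = i - + 1

  part-i : ¬ CNonempty (3 + k) j × ¬ CNonempty (1 + k) j → ¬ CNonempty (2 + k) j
  part-i (¬A , ¬C) B with nonempty⇒feasible B
  ... | s , j≡s , feasible =
    [ ¬C ∘ feasible⇒nonempty j≡s , ¬A ∘ feasible⇒nonempty j≡s ] (Feasible-split feasible)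

  part-ii : CNonempty (3 + k) j × CNonempty (1 + k) j → CNonempty (2 + k) j
  part-ii (A , C) with nonempty⇒feasible A | nonempty⇒feasible C
  ... | s , j≡s , _ , A≤3s | s′ , j≡s′ , s′≤C , _ =
    feasible⇒nonempty j≡s (Feasible-between (subst (_≤ 1 + k) s′≡s s′≤C) A≤3s)
    where
    s′≡s : s′ ≡ s
    s′≡s = +-injective (trans (sym j≡s′) j≡s)

  part-iii : ¬ CNonempty (3 + k) j × ¬ CNonempty (2 + k) j × ¬ CNonempty (1 + k) j → ¬ CNonempty (4 + k) i
  part-iii (¬A , ¬B , ¬C) N with nonempty⇒feasible N
  ... | zero , _ , _ , ()
  ... | suc s , i≡1+s , feasible =
    [ ¬C ∘ nonempty , [ ¬B ∘ nonempty , ¬A ∘ nonempty ] ] (Feasible-pred feasible)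
    where
    nonempty : ∀ {m} → Feasible (suc m) s → CNonempty (suc m) j
    nonempty = feasible⇒nonempty (cong (_- + 1) i≡1+s)
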